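{- Let $a,k\ge 1$, $r\ge 3$ and $p\ge r-1$ be integers. For large $n$, every $r$-uniform hypergraph $H\in\mathcal{K}^{r}_{n,a,k}$ has property $\bigl(\lfloor(a+1-\tfrac{1}{k})p\rfloor+1,\,p+1\bigr)$. Furthermore, $$t_{r}\bigl(\lfloor(a+1-\tfrac{1}{k})p\rfloor+1,\,p+1\bigr)\le\rho_{r}(a,k).$$
   Context: For integers $n,a,k\ge 1$ and $r\ge 3$, let $\mathcal{K}^{r}_{n,a,k}$ be the family of $r$-uniform hypergraphs $H$ on $n$ vertices whose vertex set admits a partition $V(H)=V_{1}\cup\cdots\cup V_{a}$ with $V_{a}=U_{0}\cup U_{1}\cup\cdots\cup U_{k}$ (a partition of $V_a$) such that $E(H)=\bigl(\bigcup_{i=1}^{a-1}\binom{V_{i}}{r}\bigr)\cup\binom{V_{a}\setminus U_{0}}{r}\cup\bigl(\bigcup_{j=1}^{k}\binom{U_{0}\cup U_{j}}{r}\bigr)$. Let $\rho_{r}(n,a,k)=\min\{e(H): H\in\mathcal{K}^{r}_{n,a,k}\}$ and $\rho_{r}(a,k)=\lim_{n\to\infty}\rho_{r}(n,a,k)/\binom{n}{r}$. A vertex set is a clique if all its $r$-subsets are edges; $H$ has property $(q,p)$ if every $q$-element vertex subset contains a $p$-element clique. $T_{r}(n,q,p)=\min\{e(H): H\subseteq\binom{[n]}{r} \text{ has property } (q,p)\}$ and $t_r(q,p)=\lim_{n\to\infty}T_r(n,q,p)/\binom{n}{r}$. -}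

module Defs where

open import Data.Nat using (ℕ; zero; suc; _+_; _*_; _∸_; _≤_; _≡ᵇ_; NonZero)
open import Data.Nat.DivMod using (_/_)
open import Data.Bool using (Bool; true; false; _∧_)
open import Data.Fin using (Fin; zero; suc; inject₁)
open import Data.Fin.Subset using (Subset; _⊆_; _∈_; ∣_∣)
open import Data.Vec using ([]; _∷_)
open import Data.List using (List; []; _∷_; _++_; map; filterᵇ; length)
open import Data.Sum using (_⊎_; inj₁; inj₂)
open import Data.Product using (Σ; _×_; ∃)
open import Relation.Binary.PropositionalEquality using (_≡_; _≢_)
open import Function.Bundles using (_⇔_)

-- An r-uniform hypergraph on vertex set Fin n is given by an edge indicator
-- on vertex subsets; only subsets of size exactly r are regarded as edges.
Hypergraph : ℕ → Set
Hypergraph n = Subset n → Bool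

allSubsets : (n : ℕ) → List (Subset n)
allSubsets zero = [] ∷ []
allSubsets (suc n) = map (false ∷_) (allSubsets n) ++ map (true ∷_) (allSubsets n)

edges : (r : ℕ) {n : ℕ} → Hypergraph n → ℕ
edges r {n} H = length (filterᵇ (λ S → (∣ S ∣ ≡ᵇ r) ∧ H S) (allSubsets n))

IsEdge : (r : ℕ) {n : ℕ} → Hypergraph n → Subset n → Set
IsEdge r H S = (∣ S ∣ ≡ r) × (H S ≡ true)

IsClique : (r : ℕ) {n : ℕ} → Hypergraph n → Subset n → Set
IsClique r H C = (S : Subset _) → S ⊆ C → ∣ S ∣ ≡ r → H S ≡ true

HasProperty : (r : ℕ) {n : ℕ} → ℕ → ℕ → Hypergraph n → Set
HasProperty r {n} q p H =
  (Q : Subset n) → ∣ Q ∣ ≡ q →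
  Σ (Subset n) λ C → C ⊆ Q × ∣ C ∣ ≡ p × IsClique r H C

-- A labelling of the vertices describing the partition
-- V = V_1 ∪ ... ∪ V_{a-1} ∪ V_a,  V_a = U_0 ∪ U_1 ∪ ... ∪ U_k :
-- inj₁ i  (i : Fin (a ∸ 1)) means the vertex lies in V_{i+1};
-- inj₂ j  (j : Fin (suc k)) means the vertex lies in U_j ⊆ V_a.
-- (Parts are allowed to be empty.)
Labelling : ℕ → ℕ → ℕ → Set
Labelling n a k = Fin n → Fin (a ∸ 1) ⊎ Fin (suc k)

KEdge : {n a k : ℕ} → Labelling n a k → Subset n → Set
KEdge {n} {a} {k} c S =
    (Σ (Fin (a ∸ 1)) λ i → (v : Fin n) → v ∈ S → c v ≡ inj₁ i)
  ⊎ (((v : Fin n) → v ∈ S → Σ (Fin (suc k)) λ j → (c v ≡ inj₂ j) × (j ≢ zero))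
  ⊎ (Σ (Fin k) λ j → (v : Fin n) → v ∈ S →
        (c v ≡ inj₂ zero) ⊎ (c v ≡ inj₂ (suc j))))

InK : (r n a k : ℕ) → Hypergraph n → Set
InK r n a k H = Σ (Labelling n a k) λ c →
  (S : Subset n) → ∣ S ∣ ≡ r → (H S ≡ true ⇔ KEdge {n} {a} {k} c S)

IsRho : (r n a k m : ℕ) → Set
IsRho r n a k m =
  (Σ (Hypergraph n) λ H → InK r n a k H × edges r H ≡ m)
  × ((H : Hypergraph n) → InK r n a k H → m ≤ edges r H)

IsT : (r n q p m : ℕ) → Set
IsT r n q p m =
  (Σ (Hypergraph n) λ H → HasProperty r q p H × edges r H ≡ m)
  × ((H : Hypergraph n) → HasProperty r q p H → m ≤ edges r H)

-- ⌊(a + 1 - 1/k) p⌋ = ⌊((a+1)k - 1) p / k⌋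
floorQ : (a k p : ℕ) → .{{NonZero k}} → ℕ
floorQ a k p = (((a + 1) * k ∸ 1) * p) / k

{-# OPTIONS --safe #-}
-- The parts V₁, …, V_{a-1}, U₀ ∪ U_j (1 ≤ j ≤ k) and V_a ∖ U₀ of a hypergraph in 𝒦 are cliques.
-- Taking every V_i k times, every U₀ ∪ U_j once and V_a ∖ U₀ k - 1 times gives (a + 1) k - 1
-- cliques covering each vertex exactly k times. For |Q| = ⌊((a + 1) k - 1) p / k⌋ + 1, double
-- counting gives Σ |Q ∩ C| = k |Q| > ((a + 1) k - 1) p, so some clique C of the cover meets Q in
-- at least p + 1 vertices. This holds for every n, r and p.
module Submission where

open import Defs
open import Data.Bool using (Bool; true; false; _∧_)
open import Data.Fin using (Fin; zero; suc; _≟_)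
open import Data.Fin.Subset using (Subset; _⊆_; _∈_; ∣_∣; _∩_; ⊥; inside; outside)
open import Data.Fin.Subset.Properties using (∣⊥∣≡0; ⊆-min; ⊆-trans; s⊆s; p∩q⊆p; p∩q⊆q)
open import Data.List using (List; []; _∷_; _++_; map; concat; replicate)
  renaming (tabulate to tabulateᴸ)
open import Data.List.Properties using (map-++; map-cong; map-tabulate)
open import Data.Nat using (ℕ; zero; suc; _+_; _*_; _∸_; _≤_; _<_; NonZero; s≤s; >-nonZero⁻¹)
open import Data.Nat.Combinatorics using (_C_)
open import Data.Nat.DivMod using (_/_; _%_; m≡m%n+[m/n]*n; m%n<n)
open import Data.Nat.ListAction using (sum)
open import Data.Nat.ListAction.Properties using (sum-++)
open import Data.Nat.Properties
  using ( +-commutativeSemigroup; +-comm; *-comm; *-suc; *-zeroʳ; *-identityʳ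
        ; *-distribˡ-+; _<?_; ≮⇒≥; ≤-trans; ≤-reflexive; <-≤-trans; +-monoˡ-≤; +-monoˡ-<
        ; +-cancelˡ-<; *-monoʳ-≤; m≤m+n; module ≤-Reasoning)
open import Data.Nat.Tactic.RingSolver using (solve-∀)
open import Algebra.Properties.CommutativeSemigroup +-commutativeSemigroup using (interchange)
open import Data.Product using (Σ; ∃-syntax; _×_; _,_)
open import Data.Sum using (_⊎_; inj₁; inj₂)
open import Data.Vec using ([]; _∷_; tabulate)
open import Data.Vec.Properties using ([]=⇒lookup; lookup∘tabulate)
open import Function using (_∘_)
open import Function.Bundles using (Equivalence)
open import Relation.Binary.PropositionalEquality
open import Relation.Nullary using (does; yes; no)

m<n*[m/n+1] : ∀ m n .{{_ : NonZero n}} → m < n * (m / n + 1)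
m<n*[m/n+1] m n = begin-strict
  m                   ≡⟨ m≡m%n+[m/n]*n m n ⟩
  m % n + m / n * n   <⟨ +-monoˡ-< (m / n * n) (m%n<n m n) ⟩
  n + m / n * n       ≡⟨ cong (n +_) (*-comm (m / n) n) ⟩
  n + n * (m / n)     ≡⟨ sym (*-suc n (m / n)) ⟩
  n * suc (m / n)     ≡⟨ cong (n *_) (+-comm 1 (m / n)) ⟩
  n * (m / n + 1)     ∎
  where open ≤-Reasoning

𝟙 : Bool → ℕ
𝟙 true  = 1
𝟙 false = 0

module _ {A : Set} where

  ∑ : List A → (A → ℕ) → ℕ
  ∑ xs f = sum (map f xs)

  ∑-++ : ∀ xs ys (f : A → ℕ) → ∑ (xs ++ ys) f ≡ ∑ xs f + ∑ ys f
  ∑-++ xs ys f = trans (cong sum (map-++ f xs ys)) (sum-++ (map f xs) (map f ys))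

  ∑-cong : ∀ xs {f g : A → ℕ} → (∀ x → f x ≡ g x) → ∑ xs f ≡ ∑ xs g
  ∑-cong xs f≗g = cong sum (map-cong f≗g xs)

  ∑-+ : ∀ xs (f g : A → ℕ) → ∑ xs (λ x → f x + g x) ≡ ∑ xs f + ∑ xs g
  ∑-+ []       f g = refl
  ∑-+ (x ∷ xs) f g =
    trans (cong (f x + g x +_) (∑-+ xs f g)) (interchange (f x) (g x) (∑ xs f) (∑ xs g))

  ∑-replicate : ∀ m x (f : A → ℕ) → ∑ (replicate m x) f ≡ m * f x
  ∑-replicate zero    x f = refl
  ∑-replicate (suc m) x f = cong (f x +_) (∑-replicate m x f)

  ∑-concat : ∀ xss (f : A → ℕ) → ∑ (concat xss) f ≡ sum (map (λ xs → ∑ xs f) xss)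
  ∑-concat []         f = refl
  ∑-concat (xs ∷ xss) f = trans (∑-++ xs (concat xss) f) (cong (∑ xs f +_) (∑-concat xss f))

  ∑-tabulate : ∀ {m} (g : Fin m → A) (f : A → ℕ) → ∑ (tabulateᴸ g) f ≡ sum (tabulateᴸ (f ∘ g))
  ∑-tabulate g f = cong sum (map-tabulate g f)

  ∑-zero : ∀ xs → ∑ xs (λ _ → 0) ≡ 0
  ∑-zero []       = refl
  ∑-zero (x ∷ xs) = ∑-zero xs

  pigeonhole : ∀ xs (f : A → ℕ) {p} → ∑ xs (λ _ → p) < ∑ xs f → ∃[ x ] p < f x
  pigeonhole (x ∷ xs) f {p} lt with p <? f x
  ... | yes p<fx = x , p<fx
  ... | no  p≮fx =
    pigeonhole xs f (+-cancelˡ-< p _ _ (<-≤-trans lt (+-monoˡ-≤ (∑ xs f) (≮⇒≥ p≮fx))))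

sum-tabulate-const : ∀ m c → sum (tabulateᴸ {n = m} (λ _ → c)) ≡ m * c
sum-tabulate-const zero    c = refl
sum-tabulate-const (suc m) c = cong (c +_) (sum-tabulate-const m c)

sum-tabulate-δ : ∀ {m} (i : Fin m) → sum (tabulateᴸ (λ j → 𝟙 (does (j ≟ i)))) ≡ 1
sum-tabulate-δ {suc m} zero    = cong suc (trans (sum-tabulate-const m 0) (*-zeroʳ m))
sum-tabulate-δ         (suc i) = sum-tabulate-δ i

∣∷∣ : ∀ {n} x (p : Subset n) → ∣ x ∷ p ∣ ≡ 𝟙 x + ∣ p ∣
∣∷∣ true  p = refl
∣∷∣ false p = refl

subset-of-size : ∀ {n} m (A : Subset n) → m ≤ ∣ A ∣ → ∃[ B ] B ⊆ A × ∣ B ∣ ≡ m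
subset-of-size {n} zero A _ = ⊥ , ⊆-min A , ∣⊥∣≡0 n
subset-of-size (suc m) (outside ∷ A) 1+m≤∣A∣ =
  let B , B⊆A , ∣B∣≡m = subset-of-size (suc m) A 1+m≤∣A∣ in outside ∷ B , s⊆s B⊆A , ∣B∣≡m
subset-of-size (suc m) (inside ∷ A) (s≤s m≤∣A∣) =
  let B , B⊆A , ∣B∣≡m = subset-of-size m A m≤∣A∣ in inside ∷ B , s⊆s B⊆A , cong suc ∣B∣≡m

∈-tabulate⁻ : ∀ {n} (f : Fin n → Bool) {v} → v ∈ tabulate f → f v ≡ true
∈-tabulate⁻ f {v} v∈ = trans (sym (lookup∘tabulate f v)) ([]=⇒lookup v∈)

double-count : ∀ {A : Set} {n} k (xs : List A) (P : A → Fin n → Bool) (Q : Subset n) →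
  (∀ v → ∑ xs (λ x → 𝟙 (P x v)) ≡ k) →
  ∑ xs (λ x → ∣ Q ∩ tabulate (P x) ∣) ≡ k * ∣ Q ∣
double-count k xs P []      _            = trans (∑-zero xs) (sym (*-zeroʳ k))
double-count k xs P (b ∷ Q) multiplicity = begin
  ∑ xs (λ x → ∣ (b ∧ P x zero) ∷ (Q ∩ tabulate (P x ∘ suc)) ∣)
    ≡⟨ ∑-cong xs (λ x → ∣∷∣ (b ∧ P x zero) (Q ∩ tabulate (P x ∘ suc))) ⟩
  ∑ xs (λ x → 𝟙 (b ∧ P x zero) + ∣ Q ∩ tabulate (P x ∘ suc) ∣)
    ≡⟨ ∑-+ xs _ _ ⟩
  ∑ xs (λ x → 𝟙 (b ∧ P x zero)) + ∑ xs (λ x → ∣ Q ∩ tabulate (P x ∘ suc) ∣)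
    ≡⟨ cong₂ _+_ (first-vertex b) (double-count k xs (λ x → P x ∘ suc) Q (multiplicity ∘ suc)) ⟩
  k * 𝟙 b + k * ∣ Q ∣
    ≡⟨ trans (cong (k *_) (∣∷∣ b Q)) (*-distribˡ-+ k (𝟙 b) ∣ Q ∣) ⟨
  k * ∣ b ∷ Q ∣ ∎
  where
  open ≡-Reasoning
  first-vertex : ∀ b → ∑ xs (λ x → 𝟙 (b ∧ P x zero)) ≡ k * 𝟙 b
  first-vertex true  = trans (multiplicity zero) (sym (*-identityʳ k))
  first-vertex false = trans (∑-zero xs) (sym (*-zeroʳ k))

-- With b = a - 1: block i is V_{i+1}, petal j is U₀ ∪ U_{j+1} and outer is V_a ∖ U₀.
data Part (b k : ℕ) : Set where
  block : Fin b → Part b k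
  petal : Fin k → Part b k
  outer : Part b k

covers : ∀ {b k} → Part b k → Fin b ⊎ Fin (suc k) → Bool
covers (block i) (inj₁ i′)        = does (i ≟ i′)
covers (block _) (inj₂ _)         = false
covers (petal _) (inj₁ _)         = false
covers (petal _) (inj₂ zero)      = true
covers (petal j) (inj₂ (suc j′))  = does (j ≟ j′)
covers outer     (inj₁ _)         = false
covers outer     (inj₂ zero)      = false
covers outer     (inj₂ (suc _))   = true

module _ {b k : ℕ} where

  covers-block⁻ : ∀ i ℓ → covers {b} {k} (block i) ℓ ≡ true → ℓ ≡ inj₁ i
  covers-block⁻ i (inj₁ i′) eq with i ≟ i′
  ... | yes refl = refl
  covers-block⁻ i (inj₂ _) ()

  covers-petal⁻ : ∀ j ℓ → covers {b} {k} (petal j) ℓ ≡ true → ℓ ≡ inj₂ zero ⊎ ℓ ≡ inj₂ (suc j)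
  covers-petal⁻ j (inj₂ zero)     _  = inj₁ refl
  covers-petal⁻ j (inj₂ (suc j′)) eq with j ≟ j′
  ... | yes refl = inj₂ refl
  covers-petal⁻ j (inj₁ _) ()

  covers-outer⁻ : ∀ ℓ → covers {b} {k} outer ℓ ≡ true → ∃[ j ] ℓ ≡ inj₂ j × j ≢ zero
  covers-outer⁻ (inj₂ (suc j)) _ = suc j , refl , λ ()
  covers-outer⁻ (inj₁ _)       ()
  covers-outer⁻ (inj₂ zero)    ()

cover : (b k′ : ℕ) → List (Part b (suc k′))
cover b k′ = concat (replicate (suc k′) (tabulateᴸ block)) ++ tabulateᴸ petal ++ replicate k′ outer

∑-cover : ∀ b k′ (f : Part b (suc k′) → ℕ) →
  ∑ (cover b k′) f ≡ suc k′ * sum (tabulateᴸ (f ∘ block)) + (sum (tabulateᴸ (f ∘ petal)) + k′ * f outer)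
∑-cover b k′ f = begin
  ∑ (blocks ++ tabulateᴸ petal ++ replicate k′ outer) f
    ≡⟨ ∑-++ blocks _ f ⟩
  ∑ blocks f + ∑ (tabulateᴸ petal ++ replicate k′ outer) f
    ≡⟨ cong (∑ blocks f +_) (∑-++ (tabulateᴸ petal) _ f) ⟩
  ∑ blocks f + (∑ (tabulateᴸ petal) f + ∑ (replicate k′ outer) f)
    ≡⟨ cong₂ _+_ blocks-sum (cong₂ _+_ (∑-tabulate petal f) (∑-replicate k′ outer f)) ⟩
  suc k′ * sum (tabulateᴸ (f ∘ block)) + (sum (tabulateᴸ (f ∘ petal)) + k′ * f outer) ∎
  where
  open ≡-Reasoning
  blocks = concat (replicate (suc k′) (tabulateᴸ block))
  blocks-sum : ∑ blocks f ≡ suc k′ * sum (tabulateᴸ (f ∘ block))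
  blocks-sum = trans (∑-concat (replicate (suc k′) (tabulateᴸ block)) f)
    (trans (∑-replicate (suc k′) (tabulateᴸ block) (λ ts → ∑ ts f)) (cong (suc k′ *_) (∑-tabulate block f)))

cover-multiplicity : ∀ b k′ ℓ → ∑ (cover b k′) (λ t → 𝟙 (covers t ℓ)) ≡ suc k′
cover-multiplicity b k′ ℓ = trans (∑-cover b k′ _) (by-label ℓ)
  where
  k = suc k′
  count-V : ∀ k′ → suc k′ * 1 + (suc k′ * 0 + k′ * 0) ≡ suc k′
  count-V = solve-∀
  count-U₀ : ∀ k′ b → suc k′ * (b * 0) + (suc k′ * 1 + k′ * 0) ≡ suc k′
  count-U₀ = solve-∀
  count-Uⱼ : ∀ k′ b → suc k′ * (b * 0) + (1 + k′ * 1) ≡ suc k′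
  count-Uⱼ = solve-∀
  by-label : ∀ ℓ → k * sum (tabulateᴸ (λ i → 𝟙 (covers (block i) ℓ)))
                   + (sum (tabulateᴸ (λ j → 𝟙 (covers (petal j) ℓ))) + k′ * 𝟙 (covers outer ℓ)) ≡ k
  by-label (inj₁ i) =
    trans (cong₂ (λ x y → k * x + (y + k′ * 0)) (sum-tabulate-δ i) (sum-tabulate-const k 0)) (count-V k′)
  by-label (inj₂ zero) =
    trans (cong₂ (λ x y → k * x + (y + k′ * 0)) (sum-tabulate-const b 0) (sum-tabulate-const k 1)) (count-U₀ k′ b)
  by-label (inj₂ (suc j)) =
    trans (cong₂ (λ x y → k * x + (y + k′ * 1)) (sum-tabulate-const b 0) (sum-tabulate-δ j)) (count-Uⱼ k′ b)

∑-cover-const : ∀ b k′ p → ∑ (cover b k′) (λ _ → p) ≡ ((suc b + 1) * suc k′ ∸ 1) * p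
∑-cover-const b k′ p = begin
  ∑ (cover b k′) (λ _ → p)
    ≡⟨ ∑-cover b k′ (λ _ → p) ⟩
  suc k′ * sum (tabulateᴸ {n = b} (λ _ → p)) + (sum (tabulateᴸ {n = suc k′} (λ _ → p)) + k′ * p)
    ≡⟨ cong₂ (λ x y → suc k′ * x + (y + k′ * p)) (sum-tabulate-const b p) (sum-tabulate-const (suc k′) p) ⟩
  suc k′ * (b * p) + (suc k′ * p + k′ * p)
    ≡⟨ parts-count b k′ p ⟩
  (k′ + (b + 1) * suc k′) * p ∎
  where
  open ≡-Reasoning
  -- No lemma about ∸ is needed: (suc b + 1) * suc k′ ∸ 1 reduces to k′ + (b + 1) * suc k′.
  parts-count : ∀ b k′ p → suc k′ * (b * p) + (suc k′ * p + k′ * p) ≡ (k′ + (b + 1) * suc k′) * p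
  parts-count = solve-∀

partOf : ∀ {n b k} → (Fin n → Fin b ⊎ Fin (suc k)) → Part b k → Subset n
partOf c t = tabulate (λ v → covers t (c v))

⊆-partOf⇒KEdge : ∀ {n b k} (c : Labelling n (suc b) k) t {S} → S ⊆ partOf c t → KEdge {n} {suc b} {k} c S
⊆-partOf⇒KEdge c (block i) S⊆ = inj₁ (i , λ v v∈S → covers-block⁻ i (c v) (∈-tabulate⁻ _ (S⊆ v∈S)))
⊆-partOf⇒KEdge c (petal j) S⊆ = inj₂ (inj₂ (j , λ v v∈S → covers-petal⁻ j (c v) (∈-tabulate⁻ _ (S⊆ v∈S))))
⊆-partOf⇒KEdge c outer     S⊆ = inj₂ (inj₁ λ v v∈S → covers-outer⁻ (c v) (∈-tabulate⁻ _ (S⊆ v∈S)))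

⊆-partOf⇒IsClique : ∀ {r n b k} {H : Hypergraph n} ((c , edge⇔) : InK r n (suc b) k H) t {C} →
  C ⊆ partOf c t → IsClique r H C
⊆-partOf⇒IsClique (c , edge⇔) t C⊆ S S⊆C ∣S∣≡r =
  Equivalence.from (edge⇔ S ∣S∣≡r) (⊆-partOf⇒KEdge c t (⊆-trans S⊆C C⊆))

∃-large-part : ∀ {n b k′} p (c : Labelling n (suc b) (suc k′)) (Q : Subset n) →
  ∣ Q ∣ ≡ floorQ (suc b) (suc k′) p + 1 → ∃[ t ] p < ∣ Q ∩ partOf c t ∣
∃-large-part {b = b} {k′} p c Q ∣Q∣≡q = pigeonhole (cover b k′) (λ t → ∣ Q ∩ partOf c t ∣) (begin-strict
  ∑ (cover b k′) (λ _ → p)                 ≡⟨ ∑-cover-const b k′ p ⟩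
  X                                        <⟨ m<n*[m/n+1] X k ⟩
  k * (X / k + 1)                          ≡⟨ cong (k *_) (sym ∣Q∣≡q) ⟩
  k * ∣ Q ∣                                ≡⟨ double-count k (cover b k′) (λ t v → covers t (c v)) Q
                                                (cover-multiplicity b k′ ∘ c) ⟨
  ∑ (cover b k′) (λ t → ∣ Q ∩ partOf c t ∣) ∎)
  where
  open ≤-Reasoning
  k = suc k′
  X = ((suc b + 1) * k ∸ 1) * p

InK⇒HasProperty : ∀ {r n b k′} p (H : Hypergraph n) → InK r n (suc b) (suc k′) H →
  HasProperty r (floorQ (suc b) (suc k′) p + 1) (p + 1) H
InK⇒HasProperty p H inK@(c , _) Q ∣Q∣≡q
  with t , p<∣Q∩t∣ ← ∃-large-part p c Q ∣Q∣≡q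
  with C , C⊆Q∩t , ∣C∣≡1+p ← subset-of-size (suc p) (Q ∩ partOf c t) p<∣Q∩t∣
  = C , ⊆-trans C⊆Q∩t (p∩q⊆p Q _) , trans ∣C∣≡1+p (+-comm 1 p) ,
    ⊆-partOf⇒IsClique inK t (⊆-trans C⊆Q∩t (p∩q⊆q Q _))

IsT≤IsRho : ∀ {r n a k q p t ρ} → ((H : Hypergraph n) → InK r n a k H → HasProperty r q p H) →
  IsT r n q p t → IsRho r n a k ρ → t ≤ ρ
IsT≤IsRho hasProperty (_ , T-minimal) ((H , inK , e[H]≡ρ) , _) =
  ≤-trans (T-minimal H (hasProperty H inK)) (≤-reflexive e[H]≡ρ)

theorem3p3 : (a k r p : ℕ) → .{{_ : NonZero k}} → 1 ≤ a → 3 ≤ r → r ∸ 1 ≤ p →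
    (Σ ℕ λ N → (n : ℕ) → N ≤ n → (H : Hypergraph n) → InK r n a k H →
       HasProperty r (floorQ a k p + 1) (p + 1) H)
    × ((m : ℕ) → 1 ≤ m → Σ ℕ λ N → (n t ρ : ℕ) → N ≤ n →
       IsT r n (floorQ a k p + 1) (p + 1) t → IsRho r n a k ρ →
       m * t ≤ m * ρ + n C r)
theorem3p3 zero    k        r p () _ _
theorem3p3 (suc b) zero     r p _ _ _ with () ← >-nonZero⁻¹ zero
theorem3p3 (suc b) (suc k′) r p _ _ _ =
  (0 , λ _ _ → InK⇒HasProperty p) ,
  λ m _ → 0 , λ n _ _ _ isT isRho →
    ≤-trans (*-monoʳ-≤ m (IsT≤IsRho {a = suc b} (InK⇒HasProperty p) isT isRho)) (m≤m+n _ (n C r))
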